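{- Let $a,b$ be positive integers and consider the $a$-$b$ chip-firing game started with $n$ chips at vertex $0$. Let $\sigma$ be a state reached from the initial state by a finite sequence of firings, and let $f_0(\sigma)$, $f_1(\sigma)$ be the numbers of times vertices $0$ and $1$ fire in that sequence. Then \[S_{\sigma^L}(1)=n-bf_0(\sigma)+af_1(\sigma),\qquad S_{\sigma^R}(1)=bf_0(\sigma)-af_1(\sigma),\] \[S_{\sigma^L}\!\left(\tfrac{b}{a}\right)=n-a(f_0(\sigma)-f_1(\sigma)),\qquad S_{\sigma^R}\!\left(\tfrac{b}{a}\right)=a(f_0(\sigma)-f_1(\sigma)).\]
   Context: The $a$-$b$ chip-firing game on $\mathbb{Z}$: a vertex $i$ with at least $a+b$ chips may fire, losing $a+b$ chips while vertex $i-1$ gains $a$ and vertex $i+1$ gains $b$. For a state $\sigma$ with $s_m$ chips at vertex $m$: $S_{\sigma^L}(t)=\sum_{m\le 0}s_mt^{ -m}$ (left part) and $S_{\sigma^R}(t)=\sum_{m\ge1}s_mt^{ -m}$ (right part). -}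

module Defs where

open import Data.Nat as ℕ using (ℕ; zero; suc; _≤_)
open import Data.Integer as ℤ using (ℤ; +_; -[1+_])
open import Data.Rational as ℚ using (ℚ; _/_; 1/_)
open import Data.Rational.Properties using (pos⇒nonZero; normalize-pos)
open import Data.List using (List; []; _∷_; filter; length)
open import Data.Bool using (if_then_else_)
open import Relation.Nullary.Decidable using (⌊_⌋)
open import Relation.Binary.PropositionalEquality using (_≡_)

State : Set
State = ℤ → ℕ

initial : ℕ → State
initial n m = if ⌊ m ℤ.≟ + 0 ⌋ then n else 0

fire : ℕ → ℕ → ℤ → State → State
fire a b i s m =
  if ⌊ m ℤ.≟ i ⌋ then s m ℕ.∸ (a ℕ.+ b)
  else if ⌊ m ℤ.≟ i ℤ.- + 1 ⌋ then s m ℕ.+ a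
  else if ⌊ m ℤ.≟ i ℤ.+ + 1 ⌋ then s m ℕ.+ b
  else s m

data FiringSeq (a b : ℕ) : State → List ℤ → State → Set where
  done : ∀ {s} → FiringSeq a b s [] s
  step : ∀ {s i is s'} → a ℕ.+ b ≤ s i →
         FiringSeq a b (fire a b i s) is s' → FiringSeq a b s (i ∷ is) s'

fireCount : ℤ → List ℤ → ℕ
fireCount v is = length (filter (λ j → j ℤ.≟ v) is)

SupportedIn : ℕ → State → Set
SupportedIn N s = ∀ m → N ℕ.< ℤ.∣ m ∣ → s m ≡ 0

_^ℚ_ : ℚ → ℕ → ℚ
t ^ℚ zero  = ℚ.1ℚ
t ^ℚ suc k = t ℚ.* (t ^ℚ k)

-- Truncated generating functions (they equal the full, finitely supported
-- sums whenever the state is supported in [-N, N]):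
-- S_L N s t = Σ_{m = -N}^{0} s_m t^{-m}
S-L : ℕ → State → ℚ → ℚ
S-L zero    s t = (+ s (+ 0)) / 1
S-L (suc N) s t = S-L N s t ℚ.+ ((+ s (ℤ.- (+ suc N))) / 1) ℚ.* (t ^ℚ suc N)

-- S_R N s t = Σ_{m = 1}^{N} s_m t^{-m}   (t^{-m} = (1/t)^m)
S-R : ℕ → State → (t : ℚ) → .{{ℚ.NonZero t}} → ℚ
S-R zero    s t = ℚ.0ℚ
S-R (suc N) s t = S-R N s t ℚ.+ ((+ s (+ suc N)) / 1) ℚ.* ((1/ t) ^ℚ suc N)

ratio-nonZero : (a b : ℕ) → {{_ : ℕ.NonZero a}} → {{_ : ℕ.NonZero b}} → ℚ.NonZero ((+ b) / a)
ratio-nonZero a b = pos⇒nonZero ((+ b) / a) {{normalize-pos b a}}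

module Submission where

open import Defs
open import Algebra.Bundles using (AbelianGroup)
open import Data.Bool using (if_then_else_)
open import Data.Empty using (⊥-elim)
open import Data.Integer as ℤ using (ℤ; +_; -[1+_])
import Data.Integer.Properties as ℤP
open import Data.List using (List; []; _∷_; length)
open import Data.Nat as ℕ using (ℕ; zero; suc)
import Data.Nat.Properties as ℕP
open import Data.Product using (_×_; _,_)
open import Data.Rational as ℚ using (ℚ; _/_; 1/_)
import Data.Rational.Properties as ℚP
open import Data.Rational.Solver using (module +-*-Solver)
import Data.Rational.Unnormalised as ℚᵘ
import Data.Rational.Unnormalised.Properties as ℚᵘP
open import Data.Sum using (inj₁; inj₂)
open import Relation.Binary.PropositionalEquality
open import Relation.Nullary using (yes; no)
open import Relation.Nullary.Decidable using (⌊_⌋)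
open import Algebra.Properties.Group (AbelianGroup.group ℤP.+-0-abelianGroup) using (∙-cancelˡ)
open +-*-Solver

-- Both generating functions are weighted sums Σ_m s_m w(m), with w(m) = t^(-m) on m ≤ 0 for the
-- left part and w(m) = (1/t)^m on m ≥ 1 for the right part.  Firing i changes such a sum by the
-- discrete Laplacian a w(i-1) + b w(i+1) - (a+b) w(i).  On a geometric stretch of w this is a
-- multiple of a t² - (a+b) t + b = (t - 1)(a t - b) (for the right part, of b u² - (a+b) u + a
-- with u = 1/t), which vanishes for t = 1 and t = b/a.  So only the firings of 0 and 1, where
-- the weight leaves the geometric regime, move the sums, each by a fixed amount, and the sums
-- start at n and 0.

fromℤ : ℤ → ℚ
fromℤ z = z / 1

fromℕ : ℕ → ℚ
fromℕ n = fromℤ (+ n)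

fromℚᵘ-homo-+ : ∀ p q → ℚ.fromℚᵘ (p ℚᵘ.+ q) ≡ ℚ.fromℚᵘ p ℚ.+ ℚ.fromℚᵘ q
fromℚᵘ-homo-+ p q = trans
  (ℚP.fromℚᵘ-cong (ℚᵘP.≃-sym (ℚᵘP.≃-trans
    (ℚP.toℚᵘ-homo-+ (ℚ.fromℚᵘ p) (ℚ.fromℚᵘ q))
    (ℚᵘP.+-cong (ℚP.toℚᵘ-fromℚᵘ p) (ℚP.toℚᵘ-fromℚᵘ q)))))
  (ℚP.fromℚᵘ-toℚᵘ (ℚ.fromℚᵘ p ℚ.+ ℚ.fromℚᵘ q))

fromℚᵘ-homo-* : ∀ p q → ℚ.fromℚᵘ (p ℚᵘ.* q) ≡ ℚ.fromℚᵘ p ℚ.* ℚ.fromℚᵘ q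
fromℚᵘ-homo-* p q = trans
  (ℚP.fromℚᵘ-cong (ℚᵘP.≃-sym (ℚᵘP.≃-trans
    (ℚP.toℚᵘ-homo-* (ℚ.fromℚᵘ p) (ℚ.fromℚᵘ q))
    (ℚᵘP.*-cong (ℚP.toℚᵘ-fromℚᵘ p) (ℚP.toℚᵘ-fromℚᵘ q)))))
  (ℚP.fromℚᵘ-toℚᵘ (ℚ.fromℚᵘ p ℚ.* ℚ.fromℚᵘ q))

fromℤ-+ : ∀ x y → fromℤ (x ℤ.+ y) ≡ fromℤ x ℚ.+ fromℤ y
fromℤ-+ x y = trans
  (cong fromℤ (cong₂ ℤ._+_ (sym (ℤP.*-identityʳ x)) (sym (ℤP.*-identityʳ y))))
  (fromℚᵘ-homo-+ (ℚᵘ.mkℚᵘ x 0) (ℚᵘ.mkℚᵘ y 0))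

fromℤ-* : ∀ x y → fromℤ (x ℤ.* y) ≡ fromℤ x ℚ.* fromℤ y
fromℤ-* x y = fromℚᵘ-homo-* (ℚᵘ.mkℚᵘ x 0) (ℚᵘ.mkℚᵘ y 0)

fromℤ-neg : ∀ x → fromℤ (ℤ.- x) ≡ ℚ.- fromℤ x
fromℤ-neg x = begin
  fromℤ (ℤ.- x)         ≡⟨ cong fromℤ (sym (ℤP.-1*i≡-i x)) ⟩
  fromℤ (ℤ.- + 1 ℤ.* x) ≡⟨ fromℤ-* (ℤ.- + 1) x ⟩
  ℚ.- ℚ.1ℚ ℚ.* fromℤ x  ≡⟨ solve 1 (λ y → :- con ℚ.1ℚ :* y := :- y) refl (fromℤ x) ⟩
  ℚ.- fromℤ x           ∎
  where open ≡-Reasoning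

fromℤ-- : ∀ x y → fromℤ (x ℤ.- y) ≡ fromℤ x ℚ.- fromℤ y
fromℤ-- x y = trans (fromℤ-+ x (ℤ.- y)) (cong (fromℤ x ℚ.+_) (fromℤ-neg y))

fromℕ-+ : ∀ m n → fromℕ (m ℕ.+ n) ≡ fromℕ m ℚ.+ fromℕ n
fromℕ-+ m n = fromℤ-+ (+ m) (+ n)

fromℕ-∸ : ∀ {m n} → n ℕ.≤ m → fromℕ (m ℕ.∸ n) ≡ fromℕ m ℚ.- fromℕ n
fromℕ-∸ {m} {n} n≤m = begin
  fromℕ (m ℕ.∸ n)
    ≡⟨ solve 2 (λ d y → d := d :+ y :- y) refl (fromℕ (m ℕ.∸ n)) (fromℕ n) ⟩
  fromℕ (m ℕ.∸ n) ℚ.+ fromℕ n ℚ.- fromℕ n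
    ≡⟨ cong (ℚ._- fromℕ n) (sym (fromℕ-+ (m ℕ.∸ n) n)) ⟩
  fromℕ (m ℕ.∸ n ℕ.+ n) ℚ.- fromℕ n
    ≡⟨ cong (λ k → fromℕ k ℚ.- fromℕ n) (ℕP.m∸n+n≡m n≤m) ⟩
  fromℕ m ℚ.- fromℕ n ∎
  where open ≡-Reasoning

abs-≢⇒≢ : ∀ {m p} → ℤ.∣ m ∣ ≢ ℤ.∣ p ∣ → m ≢ p
abs-≢⇒≢ ne refl = ne refl

+-≢ : ∀ i {x y} → x ≢ y → i ℤ.+ x ≢ i ℤ.+ y
+-≢ i x≢y e = x≢y (∙-cancelˡ i _ _ e)

≢-pred : ∀ i → i ≢ i ℤ.- + 1
≢-pred i e = +-≢ i {+ 0} (λ ()) (trans (ℤP.+-identityʳ i) e)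

≢-suc : ∀ i → i ≢ i ℤ.+ + 1
≢-suc i e = +-≢ i {+ 0} (λ ()) (trans (ℤP.+-identityʳ i) e)

pred≢suc : ∀ i → i ℤ.- + 1 ≢ i ℤ.+ + 1
pred≢suc i = +-≢ i (λ ())

neighbour-bound : ∀ i d → ℤ.∣ d ∣ ℕ.≤ 1 → ℤ.∣ i ℤ.+ d ∣ ℕ.≤ suc ℤ.∣ i ∣
neighbour-bound i d d≤1 = ℕP.≤-trans (ℤP.∣i+j∣≤∣i∣+∣j∣ i d)
  (ℕP.≤-trans (ℕP.+-monoʳ-≤ ℤ.∣ i ∣ d≤1) (ℕP.≤-reflexive (ℕP.+-comm ℤ.∣ i ∣ 1)))

windowSum : ℕ → (ℤ → ℚ) → ℚ
windowSum zero    f = f (+ 0)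
windowSum (suc M) f = windowSum M f ℚ.+ f -[1+ M ] ℚ.+ f (+ suc M)

windowSum-cong : ∀ M {f g : ℤ → ℚ} → (∀ m → f m ≡ g m) → windowSum M f ≡ windowSum M g
windowSum-cong zero    f≗g = f≗g (+ 0)
windowSum-cong (suc M) f≗g =
  cong₂ ℚ._+_ (cong₂ ℚ._+_ (windowSum-cong M f≗g) (f≗g -[1+ M ])) (f≗g (+ suc M))

windowSum-+ : ∀ M (f g : ℤ → ℚ) →
  windowSum M (λ m → f m ℚ.+ g m) ≡ windowSum M f ℚ.+ windowSum M g
windowSum-+ zero    f g = refl
windowSum-+ (suc M) f g rewrite windowSum-+ M f g =
  solve 6 (λ F G x y u v → F :+ G :+ (x :+ y) :+ (u :+ v) := F :+ x :+ u :+ (G :+ y :+ v)) refl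
    (windowSum M f) (windowSum M g) (f -[1+ M ]) (g -[1+ M ]) (f (+ suc M)) (g (+ suc M))

windowSum-vanishing : ∀ M {f : ℤ → ℚ} → (∀ m → ℤ.∣ m ∣ ℕ.≤ M → f m ≡ ℚ.0ℚ) →
  windowSum M f ≡ ℚ.0ℚ
windowSum-vanishing zero    f≡0 = f≡0 (+ 0) ℕ.z≤n
windowSum-vanishing (suc M) f≡0
  rewrite windowSum-vanishing M (λ m m≤M → f≡0 m (ℕP.m≤n⇒m≤1+n m≤M))
        | f≡0 -[1+ M ] ℕP.≤-refl | f≡0 (+ suc M) ℕP.≤-refl = refl

windowSum-single : ∀ M {f : ℤ → ℚ} {p} → ℤ.∣ p ∣ ℕ.≤ M →
  (∀ m → m ≢ p → f m ≡ ℚ.0ℚ) → windowSum M f ≡ f p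
windowSum-single zero {f} p≤0 off = cong f (sym (ℤP.∣i∣≡0⇒i≡0 (ℕP.n≤0⇒n≡0 p≤0)))
windowSum-single (suc M) {f} {p} p≤ off with ℕP.m≤n⇒m<n∨m≡n p≤
... | inj₁ p<
  rewrite windowSum-single M (ℕP.≤-pred p<) off
        | off -[1+ M ] (abs-≢⇒≢ (ℕP.>⇒≢ p<)) | off (+ suc M) (abs-≢⇒≢ (ℕP.>⇒≢ p<)) =
  solve 1 (λ x → x :+ con ℚ.0ℚ :+ con ℚ.0ℚ := x) refl (f p)
... | inj₂ p≡
  rewrite windowSum-vanishing M (λ m m≤M →
            off m (abs-≢⇒≢ (ℕP.<⇒≢ (subst (ℤ.∣ m ∣ ℕ.<_) (sym p≡) (ℕ.s≤s m≤M))))) =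
  onBoundary p p≡ off
  where
  onBoundary : ∀ p → ℤ.∣ p ∣ ≡ suc M → (∀ m → m ≢ p → f m ≡ ℚ.0ℚ) →
    ℚ.0ℚ ℚ.+ f -[1+ M ] ℚ.+ f (+ suc M) ≡ f p
  onBoundary (+ .(suc M)) refl off rewrite off -[1+ M ] (λ ()) =
    solve 1 (λ x → con ℚ.0ℚ :+ con ℚ.0ℚ :+ x := x) refl (f (+ suc M))
  onBoundary -[1+ .M ] refl off rewrite off (+ suc M) (λ ()) =
    solve 1 (λ x → con ℚ.0ℚ :+ x :+ con ℚ.0ℚ := x) refl (f -[1+ M ])

windowSum-extend : ∀ {N M} {f : ℤ → ℚ} → (∀ m → N ℕ.< ℤ.∣ m ∣ → f m ≡ ℚ.0ℚ) → N ℕ.≤ M →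
  windowSum M f ≡ windowSum N f
windowSum-extend {N} {zero} f≡0 N≤0 rewrite ℕP.n≤0⇒n≡0 N≤0 = refl
windowSum-extend {N} {suc M} {f} f≡0 N≤ with ℕP.m≤n⇒m<n∨m≡n N≤
... | inj₂ refl = refl
... | inj₁ N<
  rewrite windowSum-extend f≡0 (ℕP.≤-pred N<) | f≡0 -[1+ M ] N< | f≡0 (+ suc M) N< =
  solve 1 (λ x → x :+ con ℚ.0ℚ :+ con ℚ.0ℚ := x) refl (windowSum N f)

-- The test is p ≟ m rather than m ≟ p so that a `with` on the tests inside `fire`
-- does not also abstract over (and get stuck inside) `point`.
point : ℤ → ℚ → ℤ → ℚ
point p c m = if ⌊ p ℤ.≟ m ⌋ then c else ℚ.0ℚ

point-self : ∀ p c → point p c p ≡ c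
point-self p c with p ℤ.≟ p
... | yes _  = refl
... | no p≢p = ⊥-elim (p≢p refl)

point-off : ∀ {p m} c → m ≢ p → point p c m ≡ ℚ.0ℚ
point-off {p} {m} c m≢p with p ℤ.≟ m
... | yes p≡m = ⊥-elim (m≢p (sym p≡m))
... | no _    = refl

windowSum-point : ∀ M {p} c (w : ℤ → ℚ) → ℤ.∣ p ∣ ℕ.≤ M →
  windowSum M (λ m → point p c m ℚ.* w m) ≡ c ℚ.* w p
windowSum-point M {p} c w p≤M = begin
  windowSum M (λ m → point p c m ℚ.* w m) ≡⟨ windowSum-single M p≤M off ⟩
  point p c p ℚ.* w p                      ≡⟨ cong (ℚ._* w p) (point-self p c) ⟩
  c ℚ.* w p                                ∎
  where
  open ≡-Reasoning
  off : ∀ m → m ≢ p → point p c m ℚ.* w m ≡ ℚ.0ℚ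
  off m m≢p rewrite point-off c m≢p = ℚP.*-zeroˡ (w m)

firingChange : ℕ → ℕ → ℤ → ℤ → ℚ
firingChange a b i m =
  point i (ℚ.- fromℕ (a ℕ.+ b)) m ℚ.+ point (i ℤ.- + 1) (fromℕ a) m ℚ.+ point (i ℤ.+ + 1) (fromℕ b) m

firingChange-self : ∀ a b i → firingChange a b i i ≡ ℚ.- fromℕ (a ℕ.+ b)
firingChange-self a b i =
  trans (cong₂ ℚ._+_ (cong₂ ℚ._+_ (point-self i _) (point-off (fromℕ a) (≢-pred i)))
                     (point-off (fromℕ b) (≢-suc i)))
        (trans (ℚP.+-identityʳ _) (ℚP.+-identityʳ _))

firingChange-pred : ∀ a b i → firingChange a b i (i ℤ.- + 1) ≡ fromℕ a
firingChange-pred a b i =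
  trans (cong₂ ℚ._+_ (cong₂ ℚ._+_ (point-off (ℚ.- fromℕ (a ℕ.+ b)) (≢-sym (≢-pred i)))
                                  (point-self (i ℤ.- + 1) _))
                     (point-off (fromℕ b) (pred≢suc i)))
        (trans (ℚP.+-identityʳ _) (ℚP.+-identityˡ _))

firingChange-suc : ∀ a b i → firingChange a b i (i ℤ.+ + 1) ≡ fromℕ b
firingChange-suc a b i =
  trans (cong₂ ℚ._+_ (cong₂ ℚ._+_ (point-off (ℚ.- fromℕ (a ℕ.+ b)) (≢-sym (≢-suc i)))
                                  (point-off (fromℕ a) (≢-sym (pred≢suc i))))
                     (point-self (i ℤ.+ + 1) _))
        (ℚP.+-identityˡ _)

firingChange-outside : ∀ a b i {m} → m ≢ i → m ≢ i ℤ.- + 1 → m ≢ i ℤ.+ + 1 →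
  firingChange a b i m ≡ ℚ.0ℚ
firingChange-outside a b i m≢i m≢i-1 m≢i+1 =
  cong₂ ℚ._+_ (cong₂ ℚ._+_ (point-off (ℚ.- fromℕ (a ℕ.+ b)) m≢i) (point-off (fromℕ a) m≢i-1))
              (point-off (fromℕ b) m≢i+1)

fire-pointwise : ∀ a b i (s : State) m → a ℕ.+ b ℕ.≤ s i →
  fromℕ (fire a b i s m) ≡ fromℕ (s m) ℚ.+ firingChange a b i m
fire-pointwise a b i s m legal with m ℤ.≟ i
... | yes refl = trans (fromℕ-∸ legal) (cong (fromℕ (s i) ℚ.+_) (sym (firingChange-self a b i)))
... | no m≢i with m ℤ.≟ i ℤ.- + 1
...   | yes refl = trans (fromℕ-+ (s m) a) (cong (fromℕ (s m) ℚ.+_) (sym (firingChange-pred a b i)))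
...   | no m≢i-1 with m ℤ.≟ i ℤ.+ + 1
...     | yes refl = trans (fromℕ-+ (s m) b) (cong (fromℕ (s m) ℚ.+_) (sym (firingChange-suc a b i)))
...     | no m≢i+1 = sym (trans (cong (fromℕ (s m) ℚ.+_) (firingChange-outside a b i m≢i m≢i-1 m≢i+1))
                               (ℚP.+-identityʳ (fromℕ (s m))))

fire-outside : ∀ a b i (s : State) {m} → m ≢ i → m ≢ i ℤ.- + 1 → m ≢ i ℤ.+ + 1 →
  fire a b i s m ≡ s m
fire-outside a b i s {m} m≢i m≢i-1 m≢i+1 with m ℤ.≟ i
... | yes m≡i = ⊥-elim (m≢i m≡i)
... | no _ with m ℤ.≟ i ℤ.- + 1
...   | yes m≡i-1 = ⊥-elim (m≢i-1 m≡i-1)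
...   | no _ with m ℤ.≟ i ℤ.+ + 1
...     | yes m≡i+1 = ⊥-elim (m≢i+1 m≡i+1)
...     | no _ = refl

legal-in-support : ∀ a b {{_ : ℕ.NonZero a}} {K} {s : State} {i} →
  SupportedIn K s → a ℕ.+ b ℕ.≤ s i → ℤ.∣ i ∣ ℕ.≤ K
legal-in-support (suc a) b {K} {s} {i} sup legal with ℤ.∣ i ∣ ℕ.≤? K
... | yes i≤K = i≤K
... | no i≰K with () ← subst (suc a ℕ.+ b ℕ.≤_) (sup i (ℕP.≰⇒> i≰K)) legal

fire-supported : ∀ a b {K} {s : State} {i} → SupportedIn K s → ℤ.∣ i ∣ ℕ.≤ K →
  SupportedIn (suc K) (fire a b i s)
fire-supported a b {K} {s} {i} sup i≤K m K<m =
  trans (fire-outside a b i s (outside (ℕP.m≤n⇒m≤1+n i≤K))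
           (outside (ℕP.≤-trans (neighbour-bound i (ℤ.- + 1) ℕP.≤-refl) (ℕ.s≤s i≤K)))
           (outside (ℕP.≤-trans (neighbour-bound i (+ 1) ℕP.≤-refl) (ℕ.s≤s i≤K))))
        (sup m (ℕP.<-trans (ℕP.n<1+n K) K<m))
  where
  outside : ∀ {j} → ℤ.∣ j ∣ ℕ.≤ suc K → m ≢ j
  outside j≤ = abs-≢⇒≢ (ℕP.>⇒≢ (ℕP.≤-<-trans j≤ K<m))

laplacian : ℕ → ℕ → (ℤ → ℚ) → ℤ → ℚ
laplacian a b w i =
  ℚ.- fromℕ (a ℕ.+ b) ℚ.* w i ℚ.+ fromℕ a ℚ.* w (i ℤ.- + 1) ℚ.+ fromℕ b ℚ.* w (i ℤ.+ + 1)

windowSum-firingChange : ∀ a b i M (w : ℤ → ℚ) → suc ℤ.∣ i ∣ ℕ.≤ M →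
  windowSum M (λ m → firingChange a b i m ℚ.* w m) ≡ laplacian a b w i
windowSum-firingChange a b i M w i<M = begin
  windowSum M (λ m → firingChange a b i m ℚ.* w m)
    ≡⟨ windowSum-cong M (λ m → trans (ℚP.*-distribʳ-+ (w m) (P m ℚ.+ Q m) (R m))
                                     (cong (ℚ._+ R m ℚ.* w m) (ℚP.*-distribʳ-+ (w m) (P m) (Q m)))) ⟩
  windowSum M (λ m → Pw m ℚ.+ Qw m ℚ.+ Rw m)
    ≡⟨ windowSum-+ M (λ m → Pw m ℚ.+ Qw m) Rw ⟩
  windowSum M (λ m → Pw m ℚ.+ Qw m) ℚ.+ windowSum M Rw
    ≡⟨ cong (ℚ._+ windowSum M Rw) (windowSum-+ M Pw Qw) ⟩
  windowSum M Pw ℚ.+ windowSum M Qw ℚ.+ windowSum M Rw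
    ≡⟨ cong₂ ℚ._+_ (cong₂ ℚ._+_
         (windowSum-point M (ℚ.- fromℕ (a ℕ.+ b)) w (ℕP.≤-trans (ℕP.n≤1+n _) i<M))
         (windowSum-point M (fromℕ a) w (ℕP.≤-trans (neighbour-bound i (ℤ.- + 1) ℕP.≤-refl) i<M)))
         (windowSum-point M (fromℕ b) w (ℕP.≤-trans (neighbour-bound i (+ 1) ℕP.≤-refl) i<M)) ⟩
  laplacian a b w i ∎
  where
  open ≡-Reasoning
  P Q R Pw Qw Rw : ℤ → ℚ
  P = point i (ℚ.- fromℕ (a ℕ.+ b))
  Q = point (i ℤ.- + 1) (fromℕ a)
  R = point (i ℤ.+ + 1) (fromℕ b)
  Pw m = P m ℚ.* w m
  Qw m = Q m ℚ.* w m
  Rw m = R m ℚ.* w m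

weightedSum : ℕ → (ℤ → ℚ) → State → ℚ
weightedSum M w s = windowSum M (λ m → fromℕ (s m) ℚ.* w m)

weightedSum-fire : ∀ a b i M w (s : State) → a ℕ.+ b ℕ.≤ s i → suc ℤ.∣ i ∣ ℕ.≤ M →
  weightedSum M w (fire a b i s) ≡ weightedSum M w s ℚ.+ laplacian a b w i
weightedSum-fire a b i M w s legal i<M = begin
  weightedSum M w (fire a b i s)
    ≡⟨ windowSum-cong M (λ m → trans (cong (ℚ._* w m) (fire-pointwise a b i s m legal))
                                     (ℚP.*-distribʳ-+ (w m) (fromℕ (s m)) (firingChange a b i m))) ⟩
  windowSum M (λ m → fromℕ (s m) ℚ.* w m ℚ.+ Δw m)
    ≡⟨ windowSum-+ M (λ m → fromℕ (s m) ℚ.* w m) Δw ⟩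
  weightedSum M w s ℚ.+ windowSum M Δw
    ≡⟨ cong (weightedSum M w s ℚ.+_) (windowSum-firingChange a b i M w i<M) ⟩
  weightedSum M w s ℚ.+ laplacian a b w i ∎
  where
  open ≡-Reasoning
  Δw : ℤ → ℚ
  Δw m = firingChange a b i m ℚ.* w m

sumOver : (ℤ → ℚ) → List ℤ → ℚ
sumOver g []       = ℚ.0ℚ
sumOver g (i ∷ is) = g i ℚ.+ sumOver g is

weightedSum-firingSeq : ∀ a b {{_ : ℕ.NonZero a}} w {s is s'} → FiringSeq a b s is s' →
  ∀ {K M} → SupportedIn K s → K ℕ.+ length is ℕ.< M →
  weightedSum M w s' ≡ weightedSum M w s ℚ.+ sumOver (laplacian a b w) is
weightedSum-firingSeq a b w {s} done {M = M} _ _ = sym (ℚP.+-identityʳ (weightedSum M w s))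
weightedSum-firingSeq a b w {s} {i ∷ is} {s'} (step legal seq) {K} {M} sup bound = begin
  weightedSum M w s'
    ≡⟨ weightedSum-firingSeq a b w seq (fire-supported a b sup i≤K)
         (subst (ℕ._< M) (ℕP.+-suc K (length is)) bound) ⟩
  weightedSum M w (fire a b i s) ℚ.+ sumOver g is
    ≡⟨ cong (ℚ._+ sumOver g is) (weightedSum-fire a b i M w s legal i<M) ⟩
  weightedSum M w s ℚ.+ g i ℚ.+ sumOver g is
    ≡⟨ ℚP.+-assoc (weightedSum M w s) (g i) (sumOver g is) ⟩
  weightedSum M w s ℚ.+ sumOver g (i ∷ is) ∎
  where
  open ≡-Reasoning
  g = laplacian a b w
  i≤K = legal-in-support a b sup legal
  i<M : suc ℤ.∣ i ∣ ℕ.≤ M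
  i<M = ℕP.≤-trans (ℕ.s≤s (ℕP.≤-trans i≤K (ℕP.m≤m+n K (length (i ∷ is))))) bound

sumOver-fireCount : ∀ (g : ℤ → ℚ) → (∀ i → i ≢ + 0 → i ≢ + 1 → g i ≡ ℚ.0ℚ) → ∀ is →
  sumOver g is ≡ g (+ 0) ℚ.* fromℕ (fireCount (+ 0) is) ℚ.+ g (+ 1) ℚ.* fromℕ (fireCount (+ 1) is)
sumOver-fireCount g outside [] =
  solve 2 (λ g₀ g₁ → con ℚ.0ℚ := g₀ :* con ℚ.0ℚ :+ g₁ :* con ℚ.0ℚ) refl (g (+ 0)) (g (+ 1))
sumOver-fireCount g outside (+ 0 ∷ is) = begin
  g₀ ℚ.+ sumOver g is               ≡⟨ cong (g₀ ℚ.+_) (sumOver-fireCount g outside is) ⟩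
  g₀ ℚ.+ (g₀ ℚ.* x ℚ.+ g₁ ℚ.* y)
    ≡⟨ solve 4 (λ g₀ g₁ x y → g₀ :+ (g₀ :* x :+ g₁ :* y) := g₀ :* (con ℚ.1ℚ :+ x) :+ g₁ :* y)
         refl g₀ g₁ x y ⟩
  g₀ ℚ.* (ℚ.1ℚ ℚ.+ x) ℚ.+ g₁ ℚ.* y
    ≡⟨ cong (λ z → g₀ ℚ.* z ℚ.+ g₁ ℚ.* y) (sym (fromℕ-+ 1 (fireCount (+ 0) is))) ⟩
  g₀ ℚ.* fromℕ (suc (fireCount (+ 0) is)) ℚ.+ g₁ ℚ.* y ∎
  where
  open ≡-Reasoning
  g₀ = g (+ 0)
  g₁ = g (+ 1)
  x = fromℕ (fireCount (+ 0) is)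
  y = fromℕ (fireCount (+ 1) is)
sumOver-fireCount g outside (+ 1 ∷ is) = begin
  g₁ ℚ.+ sumOver g is               ≡⟨ cong (g₁ ℚ.+_) (sumOver-fireCount g outside is) ⟩
  g₁ ℚ.+ (g₀ ℚ.* x ℚ.+ g₁ ℚ.* y)
    ≡⟨ solve 4 (λ g₀ g₁ x y → g₁ :+ (g₀ :* x :+ g₁ :* y) := g₀ :* x :+ g₁ :* (con ℚ.1ℚ :+ y))
         refl g₀ g₁ x y ⟩
  g₀ ℚ.* x ℚ.+ g₁ ℚ.* (ℚ.1ℚ ℚ.+ y)
    ≡⟨ cong (λ z → g₀ ℚ.* x ℚ.+ g₁ ℚ.* z) (sym (fromℕ-+ 1 (fireCount (+ 1) is))) ⟩
  g₀ ℚ.* x ℚ.+ g₁ ℚ.* fromℕ (suc (fireCount (+ 1) is)) ∎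
  where
  open ≡-Reasoning
  g₀ = g (+ 0)
  g₁ = g (+ 1)
  x = fromℕ (fireCount (+ 0) is)
  y = fromℕ (fireCount (+ 1) is)
sumOver-fireCount g outside (+ suc (suc k) ∷ is) =
  trans (cong₂ ℚ._+_ (outside (+ suc (suc k)) (λ ()) (λ ())) (sumOver-fireCount g outside is))
        (ℚP.+-identityˡ _)
sumOver-fireCount g outside (-[1+ k ] ∷ is) =
  trans (cong₂ ℚ._+_ (outside -[1+ k ] (λ ()) (λ ())) (sumOver-fireCount g outside is))
        (ℚP.+-identityˡ _)

initial-off : ∀ n {m} → m ≢ + 0 → initial n m ≡ 0
initial-off n {m} m≢0 with m ℤ.≟ + 0
... | yes m≡0 = ⊥-elim (m≢0 m≡0)
... | no _    = refl

initial-supported : ∀ n → SupportedIn 0 (initial n)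
initial-supported n (+ 0) ()
initial-supported n (+ suc m) _ = refl
initial-supported n -[1+ m ]  _ = refl

weightedSum-initial : ∀ M n w → weightedSum M w (initial n) ≡ fromℕ n ℚ.* w (+ 0)
weightedSum-initial M n w = windowSum-single M ℕ.z≤n off
  where
  off : ∀ m → m ≢ + 0 → fromℕ (initial n m) ℚ.* w m ≡ ℚ.0ℚ
  off m m≢0 rewrite initial-off n m≢0 = ℚP.*-zeroˡ (w m)

weightedSum-after-firing : ∀ a b {{_ : ℕ.NonZero a}} w n {is σ} → FiringSeq a b (initial n) is σ →
  ∀ N → SupportedIn N σ → (∀ i → i ≢ + 0 → i ≢ + 1 → laplacian a b w i ≡ ℚ.0ℚ) →
  weightedSum N w σ ≡ fromℕ n ℚ.* w (+ 0) ℚ.+ laplacian a b w (+ 0) ℚ.* fromℕ (fireCount (+ 0) is)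
                                          ℚ.+ laplacian a b w (+ 1) ℚ.* fromℕ (fireCount (+ 1) is)
weightedSum-after-firing a b w n {is} {σ} seq N sup outside = begin
  weightedSum N w σ
    ≡⟨ sym (windowSum-extend (λ m N<m → trans (cong (λ k → fromℕ k ℚ.* w m) (sup m N<m)) (ℚP.*-zeroˡ (w m)))
                             (ℕP.m≤n+m N (suc (length is)))) ⟩
  weightedSum M w σ
    ≡⟨ weightedSum-firingSeq a b w seq (initial-supported n) (ℕP.m≤m+n (suc (length is)) N) ⟩
  weightedSum M w (initial n) ℚ.+ sumOver g is
    ≡⟨ cong₂ ℚ._+_ (weightedSum-initial M n w) (sumOver-fireCount g outside is) ⟩
  n₀ ℚ.+ (g (+ 0) ℚ.* x ℚ.+ g (+ 1) ℚ.* y)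
    ≡⟨ sym (ℚP.+-assoc n₀ (g (+ 0) ℚ.* x) (g (+ 1) ℚ.* y)) ⟩
  n₀ ℚ.+ g (+ 0) ℚ.* x ℚ.+ g (+ 1) ℚ.* y ∎
  where
  open ≡-Reasoning
  g = laplacian a b w
  n₀ = fromℕ n ℚ.* w (+ 0)
  x = fromℕ (fireCount (+ 0) is)
  y = fromℕ (fireCount (+ 1) is)
  M = suc (length is) ℕ.+ N

leftWeight : ℚ → ℤ → ℚ
leftWeight t (+ 0)     = ℚ.1ℚ
leftWeight t (+ suc _) = ℚ.0ℚ
leftWeight t -[1+ k ]  = t ^ℚ suc k

rightWeight : ℚ → ℤ → ℚ
rightWeight u (+ 0)     = ℚ.0ℚ
rightWeight u (+ suc k) = u ^ℚ suc k
rightWeight u -[1+ _ ]  = ℚ.0ℚ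

S-L≡weightedSum : ∀ N (s : State) t → S-L N s t ≡ weightedSum N (leftWeight t) s
S-L≡weightedSum zero    s t = sym (ℚP.*-identityʳ (fromℕ (s (+ 0))))
S-L≡weightedSum (suc N) s t = begin
  S-L N s t ℚ.+ x                   ≡⟨ cong (ℚ._+ x) (S-L≡weightedSum N s t) ⟩
  weightedSum N (leftWeight t) s ℚ.+ x
    ≡⟨ solve 3 (λ W x y → W :+ x := W :+ x :+ y :* con ℚ.0ℚ) refl
         (weightedSum N (leftWeight t) s) x (fromℕ (s (+ suc N))) ⟩
  weightedSum (suc N) (leftWeight t) s ∎
  where
  open ≡-Reasoning
  x = fromℕ (s -[1+ N ]) ℚ.* (t ^ℚ suc N)

S-R≡weightedSum : ∀ N (s : State) t .{{_ : ℚ.NonZero t}} →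
  S-R N s t ≡ weightedSum N (rightWeight (1/ t)) s
S-R≡weightedSum zero    s t = sym (ℚP.*-zeroʳ (fromℕ (s (+ 0))))
S-R≡weightedSum (suc N) s t = begin
  S-R N s t ℚ.+ y                   ≡⟨ cong (ℚ._+ y) (S-R≡weightedSum N s t) ⟩
  weightedSum N (rightWeight (1/ t)) s ℚ.+ y
    ≡⟨ solve 3 (λ W x y → W :+ y := W :+ x :* con ℚ.0ℚ :+ y) refl
         (weightedSum N (rightWeight (1/ t)) s) (fromℕ (s -[1+ N ])) y ⟩
  weightedSum (suc N) (rightWeight (1/ t)) s ∎
  where
  open ≡-Reasoning
  y = fromℕ (s (+ suc N)) ℚ.* ((1/ t) ^ℚ suc N)

IsCharRoot : ℕ → ℕ → ℚ → Set
IsCharRoot a b t = fromℕ a ℚ.* (t ℚ.* t) ℚ.+ fromℕ b ≡ fromℕ (a ℕ.+ b) ℚ.* t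

isCharRoot-one : ∀ a b → IsCharRoot a b ℚ.1ℚ
isCharRoot-one a b = begin
  fromℕ a ℚ.* (ℚ.1ℚ ℚ.* ℚ.1ℚ) ℚ.+ fromℕ b
    ≡⟨ solve 2 (λ A B → A :* (con ℚ.1ℚ :* con ℚ.1ℚ) :+ B := (A :+ B) :* con ℚ.1ℚ) refl
         (fromℕ a) (fromℕ b) ⟩
  (fromℕ a ℚ.+ fromℕ b) ℚ.* ℚ.1ℚ ≡⟨ cong (ℚ._* ℚ.1ℚ) (sym (fromℕ-+ a b)) ⟩
  fromℕ (a ℕ.+ b) ℚ.* ℚ.1ℚ       ∎
  where open ≡-Reasoning

isCharRoot-ratio : ∀ a b {t} → fromℕ a ℚ.* t ≡ fromℕ b → IsCharRoot a b t
isCharRoot-ratio a b {t} at≡b = begin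
  A ℚ.* (t ℚ.* t) ℚ.+ B ≡⟨ solve 3 (λ A B t → A :* (t :* t) :+ B := A :* t :* t :+ B) refl A B t ⟩
  A ℚ.* t ℚ.* t ℚ.+ B   ≡⟨ cong₂ (λ p q → p ℚ.* t ℚ.+ q) at≡b (sym at≡b) ⟩
  B ℚ.* t ℚ.+ A ℚ.* t   ≡⟨ solve 3 (λ A B t → B :* t :+ A :* t := (A :+ B) :* t) refl A B t ⟩
  (A ℚ.+ B) ℚ.* t       ≡⟨ cong (ℚ._* t) (sym (fromℕ-+ a b)) ⟩
  fromℕ (a ℕ.+ b) ℚ.* t ∎
  where
  open ≡-Reasoning
  A = fromℕ a
  B = fromℕ b

root⇒geometric-recurrence : ∀ A B C t → A ℚ.* (t ℚ.* t) ℚ.+ B ≡ C ℚ.* t → ∀ W →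
  ℚ.- C ℚ.* (t ℚ.* W) ℚ.+ A ℚ.* (t ℚ.* (t ℚ.* W)) ℚ.+ B ℚ.* W ≡ ℚ.0ℚ
root⇒geometric-recurrence A B C t root W = begin
  ℚ.- C ℚ.* (t ℚ.* W) ℚ.+ A ℚ.* (t ℚ.* (t ℚ.* W)) ℚ.+ B ℚ.* W
    ≡⟨ solve 5 (λ A B C t W → :- C :* (t :* W) :+ A :* (t :* (t :* W)) :+ B :* W
                              := (A :* (t :* t) :+ B) :* W :- C :* t :* W) refl A B C t W ⟩
  (A ℚ.* (t ℚ.* t) ℚ.+ B) ℚ.* W ℚ.- C ℚ.* t ℚ.* W
    ≡⟨ cong (λ z → z ℚ.* W ℚ.- C ℚ.* t ℚ.* W) root ⟩
  C ℚ.* t ℚ.* W ℚ.- C ℚ.* t ℚ.* W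
    ≡⟨ ℚP.+-inverseʳ (C ℚ.* t ℚ.* W) ⟩
  ℚ.0ℚ ∎
  where open ≡-Reasoning

laplacian-of-zero : ∀ a b →
  ℚ.- fromℕ (a ℕ.+ b) ℚ.* ℚ.0ℚ ℚ.+ fromℕ a ℚ.* ℚ.0ℚ ℚ.+ fromℕ b ℚ.* ℚ.0ℚ ≡ ℚ.0ℚ
laplacian-of-zero a b =
  solve 3 (λ C A B → :- C :* con ℚ.0ℚ :+ A :* con ℚ.0ℚ :+ B :* con ℚ.0ℚ := con ℚ.0ℚ) refl
    (fromℕ (a ℕ.+ b)) (fromℕ a) (fromℕ b)

laplacian-leftWeight-0 : ∀ a b t →
  laplacian a b (leftWeight t) (+ 0) ≡ fromℕ a ℚ.* t ℚ.- fromℕ (a ℕ.+ b)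
laplacian-leftWeight-0 a b t =
  solve 4 (λ C A B t → :- C :* con ℚ.1ℚ :+ A :* (t :* con ℚ.1ℚ) :+ B :* con ℚ.0ℚ := A :* t :- C)
    refl (fromℕ (a ℕ.+ b)) (fromℕ a) (fromℕ b) t

laplacian-leftWeight-1 : ∀ a b t → laplacian a b (leftWeight t) (+ 1) ≡ fromℕ a
laplacian-leftWeight-1 a b t =
  solve 3 (λ C A B → :- C :* con ℚ.0ℚ :+ A :* con ℚ.1ℚ :+ B :* con ℚ.0ℚ := A) refl
    (fromℕ (a ℕ.+ b)) (fromℕ a) (fromℕ b)

laplacian-leftWeight-outside : ∀ {a b t} → IsCharRoot a b t → ∀ i → i ≢ + 0 → i ≢ + 1 →
  laplacian a b (leftWeight t) i ≡ ℚ.0ℚ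
laplacian-leftWeight-outside root (+ 0) i≢0 _ = ⊥-elim (i≢0 refl)
laplacian-leftWeight-outside root (+ 1) _ i≢1 = ⊥-elim (i≢1 refl)
laplacian-leftWeight-outside {a} {b} root (+ suc (suc k)) _ _ = laplacian-of-zero a b
laplacian-leftWeight-outside {a} {b} {t} root -[1+ 0 ] _ _ =
  root⇒geometric-recurrence (fromℕ a) (fromℕ b) (fromℕ (a ℕ.+ b)) t root ℚ.1ℚ
laplacian-leftWeight-outside {a} {b} {t} root -[1+ suc k ] _ _ rewrite ℕP.+-identityʳ k =
  root⇒geometric-recurrence (fromℕ a) (fromℕ b) (fromℕ (a ℕ.+ b)) t root (t ^ℚ suc k)

laplacian-rightWeight-0 : ∀ a b u → laplacian a b (rightWeight u) (+ 0) ≡ fromℕ b ℚ.* u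
laplacian-rightWeight-0 a b u =
  solve 4 (λ C A B u → :- C :* con ℚ.0ℚ :+ A :* con ℚ.0ℚ :+ B :* (u :* con ℚ.1ℚ) := B :* u) refl
    (fromℕ (a ℕ.+ b)) (fromℕ a) (fromℕ b) u

laplacian-rightWeight-1 : ∀ {a b u} → IsCharRoot b a u →
  laplacian a b (rightWeight u) (+ 1) ≡ ℚ.- fromℕ a
laplacian-rightWeight-1 {a} {b} {u} root = begin
  ℚ.- C ℚ.* (u ℚ.* ℚ.1ℚ) ℚ.+ A ℚ.* ℚ.0ℚ ℚ.+ B ℚ.* (u ℚ.* (u ℚ.* ℚ.1ℚ))
    ≡⟨ solve 4 (λ A B C u → :- C :* (u :* con ℚ.1ℚ) :+ A :* con ℚ.0ℚ :+ B :* (u :* (u :* con ℚ.1ℚ))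
                            := B :* (u :* u) :+ A :- C :* u :- A) refl A B C u ⟩
  B ℚ.* (u ℚ.* u) ℚ.+ A ℚ.- C ℚ.* u ℚ.- A
    ≡⟨ cong (λ z → z ℚ.- C ℚ.* u ℚ.- A) (trans root (cong (λ c → fromℕ c ℚ.* u) (ℕP.+-comm b a))) ⟩
  C ℚ.* u ℚ.- C ℚ.* u ℚ.- A
    ≡⟨ solve 3 (λ A C u → C :* u :- C :* u :- A := :- A) refl A C u ⟩
  ℚ.- A ∎
  where
  open ≡-Reasoning
  A = fromℕ a
  B = fromℕ b
  C = fromℕ (a ℕ.+ b)

laplacian-rightWeight-outside : ∀ {a b u} → IsCharRoot b a u → ∀ i → i ≢ + 0 → i ≢ + 1 →
  laplacian a b (rightWeight u) i ≡ ℚ.0ℚ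
laplacian-rightWeight-outside root (+ 0) i≢0 _ = ⊥-elim (i≢0 refl)
laplacian-rightWeight-outside root (+ 1) _ i≢1 = ⊥-elim (i≢1 refl)
laplacian-rightWeight-outside {a} {b} {u} root (+ suc (suc k)) _ _ rewrite ℕP.+-comm k 1 = begin
  ℚ.- C ℚ.* (u ℚ.* W) ℚ.+ A ℚ.* W ℚ.+ B ℚ.* (u ℚ.* (u ℚ.* W))
    ≡⟨ solve 5 (λ C A B u W → :- C :* (u :* W) :+ A :* W :+ B :* (u :* (u :* W))
                              := :- C :* (u :* W) :+ B :* (u :* (u :* W)) :+ A :* W) refl C A B u W ⟩
  ℚ.- C ℚ.* (u ℚ.* W) ℚ.+ B ℚ.* (u ℚ.* (u ℚ.* W)) ℚ.+ A ℚ.* W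
    ≡⟨ root⇒geometric-recurrence B A C u (trans root (cong (λ c → fromℕ c ℚ.* u) (ℕP.+-comm b a))) W ⟩
  ℚ.0ℚ ∎
  where
  open ≡-Reasoning
  A = fromℕ a
  B = fromℕ b
  C = fromℕ (a ℕ.+ b)
  W = u ^ℚ suc k
laplacian-rightWeight-outside {a} {b} root -[1+ 0 ]     _ _ = laplacian-of-zero a b
laplacian-rightWeight-outside {a} {b} root -[1+ suc k ] _ _ = laplacian-of-zero a b

S-L-after-firing : ∀ a b {{_ : ℕ.NonZero a}} n {is σ} → FiringSeq a b (initial n) is σ →
  ∀ N → SupportedIn N σ → ∀ {t} → IsCharRoot a b t →
  S-L N σ t ≡ fromℕ n ℚ.+ (fromℕ a ℚ.* t ℚ.- fromℕ (a ℕ.+ b)) ℚ.* fromℕ (fireCount (+ 0) is)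
                      ℚ.+ fromℕ a ℚ.* fromℕ (fireCount (+ 1) is)
S-L-after-firing a b n {is} {σ} seq N sup {t} root = begin
  S-L N σ t
    ≡⟨ S-L≡weightedSum N σ t ⟩
  weightedSum N w σ
    ≡⟨ weightedSum-after-firing a b w n seq N sup (laplacian-leftWeight-outside {a} {b} {t} root) ⟩
  fromℕ n ℚ.* ℚ.1ℚ ℚ.+ laplacian a b w (+ 0) ℚ.* x ℚ.+ laplacian a b w (+ 1) ℚ.* y
    ≡⟨ cong₂ ℚ._+_ (cong₂ ℚ._+_ (ℚP.*-identityʳ (fromℕ n)) (cong (ℚ._* x) (laplacian-leftWeight-0 a b t)))
                   (cong (ℚ._* y) (laplacian-leftWeight-1 a b t)) ⟩
  fromℕ n ℚ.+ (fromℕ a ℚ.* t ℚ.- fromℕ (a ℕ.+ b)) ℚ.* x ℚ.+ fromℕ a ℚ.* y ∎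
  where
  open ≡-Reasoning
  w = leftWeight t
  x = fromℕ (fireCount (+ 0) is)
  y = fromℕ (fireCount (+ 1) is)

S-R-after-firing : ∀ a b {{_ : ℕ.NonZero a}} n {is σ} → FiringSeq a b (initial n) is σ →
  ∀ N → SupportedIn N σ → ∀ t .{{_ : ℚ.NonZero t}} → IsCharRoot b a (1/ t) →
  S-R N σ t ≡ fromℕ b ℚ.* (1/ t) ℚ.* fromℕ (fireCount (+ 0) is) ℚ.- fromℕ a ℚ.* fromℕ (fireCount (+ 1) is)
S-R-after-firing a b n {is} {σ} seq N sup t root = begin
  S-R N σ t
    ≡⟨ S-R≡weightedSum N σ t ⟩
  weightedSum N w σ
    ≡⟨ weightedSum-after-firing a b w n seq N sup (laplacian-rightWeight-outside {a} {b} {u} root) ⟩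
  fromℕ n ℚ.* ℚ.0ℚ ℚ.+ laplacian a b w (+ 0) ℚ.* x ℚ.+ laplacian a b w (+ 1) ℚ.* y
    ≡⟨ cong₂ (λ p q → fromℕ n ℚ.* ℚ.0ℚ ℚ.+ p ℚ.* x ℚ.+ q ℚ.* y)
         (laplacian-rightWeight-0 a b u) (laplacian-rightWeight-1 {a} {b} {u} root) ⟩
  fromℕ n ℚ.* ℚ.0ℚ ℚ.+ fromℕ b ℚ.* u ℚ.* x ℚ.+ ℚ.- fromℕ a ℚ.* y
    ≡⟨ solve 6 (λ n A B u x y → n :* con ℚ.0ℚ :+ B :* u :* x :+ :- A :* y := B :* u :* x :- A :* y)
         refl (fromℕ n) (fromℕ a) (fromℕ b) u x y ⟩
  fromℕ b ℚ.* u ℚ.* x ℚ.- fromℕ a ℚ.* y ∎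
  where
  open ≡-Reasoning
  u = 1/ t
  w = rightWeight u
  x = fromℕ (fireCount (+ 0) is)
  y = fromℕ (fireCount (+ 1) is)

*-ratio : ∀ a b {{_ : ℕ.NonZero a}} → fromℕ a ℚ.* ((+ b) / a) ≡ fromℕ b
*-ratio (suc a) b = trans (ℚP.*-comm (fromℕ (suc a)) ((+ b) / suc a)) (trans
  (sym (fromℚᵘ-homo-* (ℚᵘ.mkℚᵘ (+ b) a) (ℚᵘ.mkℚᵘ (+ suc a) 0)))
  (ℚP.fromℚᵘ-cong {ℚᵘ.mkℚᵘ (+ b) a ℚᵘ.* ℚᵘ.mkℚᵘ (+ suc a) 0} {ℚᵘ.mkℚᵘ (+ b) 0}
    (ℚᵘ.*≡* (ℤP.*-assoc (+ b) (+ suc a) (+ 1)))))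

*-inverse-ratio : ∀ a b {{_ : ℕ.NonZero a}} {{_ : ℕ.NonZero b}} →
  fromℕ b ℚ.* (1/ ((+ b) / a)) {{ratio-nonZero a b}} ≡ fromℕ a
*-inverse-ratio a b = begin
  fromℕ b ℚ.* u         ≡⟨ cong (ℚ._* u) (sym (*-ratio a b)) ⟩
  fromℕ a ℚ.* q ℚ.* u   ≡⟨ ℚP.*-assoc (fromℕ a) q u ⟩
  fromℕ a ℚ.* (q ℚ.* u) ≡⟨ cong (fromℕ a ℚ.*_) (ℚP.*-inverseʳ q {{ratio-nonZero a b}}) ⟩
  fromℕ a ℚ.* ℚ.1ℚ      ≡⟨ ℚP.*-identityʳ (fromℕ a) ⟩
  fromℕ a               ∎
  where
  open ≡-Reasoning
  q = (+ b) / a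
  u = (1/ q) {{ratio-nonZero a b}}

module _ (a b : ℕ) {{_ : ℕ.NonZero a}} (n : ℕ) {is : List ℤ} {σ : State}
         (seq : FiringSeq a b (initial n) is σ) (N : ℕ) (sup : SupportedIn N σ) where

  private
    f₀ f₁ : ℤ
    f₀ = + fireCount (+ 0) is
    f₁ = + fireCount (+ 1) is
    A B x y : ℚ
    A = fromℕ a
    B = fromℕ b
    x = fromℤ f₀
    y = fromℤ f₁

  S-L-at-one : S-L N σ ℚ.1ℚ ≡ fromℤ (+ n ℤ.- + b ℤ.* f₀ ℤ.+ + a ℤ.* f₁)
  S-L-at-one = begin
    S-L N σ ℚ.1ℚ
      ≡⟨ S-L-after-firing a b n seq N sup (isCharRoot-one a b) ⟩
    fromℕ n ℚ.+ (A ℚ.* ℚ.1ℚ ℚ.- fromℕ (a ℕ.+ b)) ℚ.* x ℚ.+ A ℚ.* y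
      ≡⟨ cong (λ c → fromℕ n ℚ.+ (A ℚ.* ℚ.1ℚ ℚ.- c) ℚ.* x ℚ.+ A ℚ.* y) (fromℕ-+ a b) ⟩
    fromℕ n ℚ.+ (A ℚ.* ℚ.1ℚ ℚ.- (A ℚ.+ B)) ℚ.* x ℚ.+ A ℚ.* y
      ≡⟨ solve 5 (λ n A B x y → n :+ (A :* con ℚ.1ℚ :- (A :+ B)) :* x :+ A :* y
                                := n :- B :* x :+ A :* y) refl (fromℕ n) A B x y ⟩
    fromℕ n ℚ.- B ℚ.* x ℚ.+ A ℚ.* y
      ≡⟨ sym (trans (fromℤ-+ (+ n ℤ.- + b ℤ.* f₀) (+ a ℤ.* f₁))
               (cong₂ ℚ._+_ (trans (fromℤ-- (+ n) (+ b ℤ.* f₀))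
                                   (cong (λ z → fromℕ n ℚ.- z) (fromℤ-* (+ b) f₀)))
                            (fromℤ-* (+ a) f₁))) ⟩
    fromℤ (+ n ℤ.- + b ℤ.* f₀ ℤ.+ + a ℤ.* f₁) ∎
    where open ≡-Reasoning

  S-R-at-one : S-R N σ ℚ.1ℚ ≡ fromℤ (+ b ℤ.* f₀ ℤ.- + a ℤ.* f₁)
  S-R-at-one = begin
    S-R N σ ℚ.1ℚ                 ≡⟨ S-R-after-firing a b n seq N sup ℚ.1ℚ (isCharRoot-one b a) ⟩
    B ℚ.* ℚ.1ℚ ℚ.* x ℚ.- A ℚ.* y ≡⟨ cong (λ z → z ℚ.* x ℚ.- A ℚ.* y) (ℚP.*-identityʳ B) ⟩
    B ℚ.* x ℚ.- A ℚ.* y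
      ≡⟨ sym (trans (fromℤ-- (+ b ℤ.* f₀) (+ a ℤ.* f₁))
                    (cong₂ ℚ._-_ (fromℤ-* (+ b) f₀) (fromℤ-* (+ a) f₁))) ⟩
    fromℤ (+ b ℤ.* f₀ ℤ.- + a ℤ.* f₁) ∎
    where open ≡-Reasoning

  module _ {{_ : ℕ.NonZero b}} where

    private
      q u : ℚ
      q = (+ b) / a
      u = (1/ q) {{ratio-nonZero a b}}

    S-L-at-ratio : S-L N σ q ≡ fromℤ (+ n ℤ.- + a ℤ.* (f₀ ℤ.- f₁))
    S-L-at-ratio = begin
      S-L N σ q
        ≡⟨ S-L-after-firing a b n seq N sup (isCharRoot-ratio a b (*-ratio a b)) ⟩
      fromℕ n ℚ.+ (A ℚ.* q ℚ.- fromℕ (a ℕ.+ b)) ℚ.* x ℚ.+ A ℚ.* y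
        ≡⟨ cong₂ (λ p c → fromℕ n ℚ.+ (p ℚ.- c) ℚ.* x ℚ.+ A ℚ.* y) (*-ratio a b) (fromℕ-+ a b) ⟩
      fromℕ n ℚ.+ (B ℚ.- (A ℚ.+ B)) ℚ.* x ℚ.+ A ℚ.* y
        ≡⟨ solve 5 (λ n A B x y → n :+ (B :- (A :+ B)) :* x :+ A :* y := n :- A :* (x :- y))
             refl (fromℕ n) A B x y ⟩
      fromℕ n ℚ.- A ℚ.* (x ℚ.- y)
        ≡⟨ sym (trans (fromℤ-- (+ n) (+ a ℤ.* (f₀ ℤ.- f₁)))
                 (cong (λ z → fromℕ n ℚ.- z)
                   (trans (fromℤ-* (+ a) (f₀ ℤ.- f₁)) (cong (A ℚ.*_) (fromℤ-- f₀ f₁))))) ⟩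
      fromℤ (+ n ℤ.- + a ℤ.* (f₀ ℤ.- f₁)) ∎
      where open ≡-Reasoning

    S-R-at-ratio : S-R N σ q {{ratio-nonZero a b}} ≡ fromℤ (+ a ℤ.* (f₀ ℤ.- f₁))
    S-R-at-ratio = begin
      S-R N σ q {{ratio-nonZero a b}}
        ≡⟨ S-R-after-firing a b n seq N sup q {{ratio-nonZero a b}}
             (isCharRoot-ratio b a (*-inverse-ratio a b)) ⟩
      B ℚ.* u ℚ.* x ℚ.- A ℚ.* y ≡⟨ cong (λ z → z ℚ.* x ℚ.- A ℚ.* y) (*-inverse-ratio a b) ⟩
      A ℚ.* x ℚ.- A ℚ.* y       ≡⟨ solve 3 (λ A x y → A :* x :- A :* y := A :* (x :- y)) refl A x y ⟩
      A ℚ.* (x ℚ.- y)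
        ≡⟨ sym (trans (fromℤ-* (+ a) (f₀ ℤ.- f₁)) (cong (A ℚ.*_) (fromℤ-- f₀ f₁))) ⟩
      fromℤ (+ a ℤ.* (f₀ ℤ.- f₁)) ∎
      where open ≡-Reasoning

mainTheorem4 : (a b : ℕ) → {{_ : ℕ.NonZero a}} → {{_ : ℕ.NonZero b}} →
    (n : ℕ) (is : List ℤ) (σ : State) → FiringSeq a b (initial n) is σ →
    (N : ℕ) → SupportedIn N σ →
    let f₀ = + fireCount (+ 0) is
        f₁ = + fireCount (+ 1) is
    in (S-L N σ ℚ.1ℚ ≡ (+ n ℤ.- + b ℤ.* f₀ ℤ.+ + a ℤ.* f₁) / 1)
     × (S-R N σ ℚ.1ℚ ≡ (+ b ℤ.* f₀ ℤ.- + a ℤ.* f₁) / 1)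
     × (S-L N σ ((+ b) / a) ≡ (+ n ℤ.- + a ℤ.* (f₀ ℤ.- f₁)) / 1)
     × (S-R N σ ((+ b) / a) {{ratio-nonZero a b}} ≡ (+ a ℤ.* (f₀ ℤ.- f₁)) / 1)
mainTheorem4 a b n is σ seq N sup =
  S-L-at-one a b n seq N sup , S-R-at-one a b n seq N sup ,
  S-L-at-ratio a b n seq N sup , S-R-at-ratio a b n seq N sup
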